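{- For every positive integer $n$, the octonion $(2,2,2,2,2,2,2,2n)\in\mathbb{Z}^8$ is not a sum $p+q$ of two Kleinian primes $p,q$ all of whose coordinates are positive.
   Context: Octonions are identified with vectors in $\mathbb{R}^8$, with norm $N(x_1,\dots,x_8)=x_1^2+\dots+x_8^2$. A Kleinian prime is an element of $\mathbb{Z}^8+(\tfrac12,\dots,\tfrac12)$ (all eight coordinates half-odd integers) whose norm is a rational prime. -}

module Defs where

open import Data.Nat using (ℕ; suc; _+_; _*_)
open import Data.Nat.Primality using (Prime)
open import Data.Integer as ℤ using (ℤ; +_; +[1+_]; _<_) renaming (_+_ to _+ℤ_; _*_ to _*ℤ_)
open import Data.Fin using (Fin)
open import Data.Vec using (Vec; lookup; foldr; map; zipWith; replicate; _∷_; [])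
open import Data.Product using (Σ; _×_)
open import Relation.Binary.PropositionalEquality using (_≡_)

-- An octonion with coordinates in (1/2)ℤ is represented by its DOUBLED
-- coordinate vector  d ∈ ℤ^8,  i.e. the octonion is  d / 2.
Half8 : Set
Half8 = Vec ℤ 8

Odd : ℤ → Set
Odd d = Σ ℤ (λ k → d ≡ (+ 2) *ℤ k +ℤ + 1)

-- sum of squares of the doubled coordinates; equals 4 · N(d/2)
sumSq : Half8 → ℤ
sumSq d = foldr _ _+ℤ_ (+ 0) (map (λ x → x *ℤ x) d)

HasNorm : Half8 → ℕ → Set
HasNorm d r = sumSq d ≡ + (4 * r)

-- x = d/2 lies in ℤ^8 + (1/2,…,1/2): every doubled coordinate is odd
InKleinShift : Half8 → Set
InKleinShift d = (i : Fin 8) → Odd (lookup d i)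

KleinianPrime : Half8 → Set
KleinianPrime d = InKleinShift d × Σ ℕ (λ r → HasNorm d r × Prime r)

AllPositive : Half8 → Set
AllPositive d = (i : Fin 8) → + 0 < lookup d i

_⊕_ : Half8 → Half8 → Half8
p ⊕ q = zipWith _+ℤ_ p q

target : ℕ → Half8
target n = + 4 ∷ + 4 ∷ + 4 ∷ + 4 ∷ + 4 ∷ + 4 ∷ + 4 ∷ + (4 * n) ∷ []

-- An odd square is 1 mod 8, so eight odd squares sum to 8 mod 16 and every
-- Kleinian prime has norm 2 + 2T, where T ≥ 0 measures how far its doubled
-- coordinates are from ±1. A prime norm must be 2, forcing T = 0; with positive
-- coordinates this leaves only (1/2, …, 1/2). Hence a sum of two such primes is
-- (1, …, 1), never (2, …, 2, 2n).
module Submission where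

open import Defs
open import Data.Nat using (ℕ; zero; suc; _+_; _*_)
open import Data.Nat.Properties using (*-cancelˡ-≡; *-cancelʳ-≡; suc-injective; m+n≡0⇒m≡0; m+n≡0⇒n≡0; +-comm)
open import Data.Nat.Divisibility using (_∣_; divides)
open import Data.Nat.Primality using (Prime; prime⇒irreducible)
open import Data.Nat.Solver using (module +-*-Solver)
open import Data.Integer as ℤ using (ℤ; +_; -[1+_]) renaming (_+_ to _+ℤ_; _*_ to _*ℤ_)
open import Data.Integer.Properties using (+-injective; pos-*)
open import Data.Fin using (Fin)
open import Data.Vec using (Vec; lookup; foldr; map; replicate; _∷_; [])
open import Data.Product using (Σ; _×_; _,_)
open import Data.Sum using (inj₂)
open import Relation.Binary.PropositionalEquality using (_≡_; refl; cong; cong₂; sym; trans; module ≡-Reasoning)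
open import Relation.Nullary using (¬_)
open +-*-Solver

-- sumSq at every length; it agrees with sumSq definitionally on Half8.
sumOfSquares : ∀ {k} → Vec ℤ k → ℤ
sumOfSquares d = foldr _ _+ℤ_ (+ 0) (map (λ x → x *ℤ x) d)

positive-odd : ∀ {d} → Odd d → + 0 ℤ.< d → Σ ℕ (λ m → d ≡ + (1 + 2 * m))
positive-odd (+ m , refl) _ =
  m , trans (cong (_+ℤ + 1) (sym (pos-* 2 m))) (cong +_ (+-comm (2 * m) 1))
positive-odd (-[1+ zero ] , refl) ()
positive-odd (-[1+ suc m ] , refl) ()

triangle : ℕ → ℕ
triangle zero    = 0
triangle (suc m) = suc m + triangle m

triangle≡0⇒≡0 : ∀ m → triangle m ≡ 0 → m ≡ 0
triangle≡0⇒≡0 zero _ = refl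

odd-square : ∀ m → (1 + 2 * m) * (1 + 2 * m) ≡ 1 + 8 * triangle m
odd-square zero    = refl
odd-square (suc m) = begin
  (1 + 2 * suc m) * (1 + 2 * suc m)       ≡⟨ expand m ⟩
  (1 + 2 * m) * (1 + 2 * m) + 8 * suc m   ≡⟨ cong (_+ 8 * suc m) (odd-square m) ⟩
  1 + 8 * triangle m + 8 * suc m          ≡⟨ regroup (triangle m) (suc m) ⟩
  1 + 8 * triangle (suc m)                ∎
  where
  open ≡-Reasoning
  expand : ∀ m → (1 + 2 * suc m) * (1 + 2 * suc m) ≡ (1 + 2 * m) * (1 + 2 * m) + 8 * suc m
  expand = solve 1 (λ m → (con 1 :+ con 2 :* (con 1 :+ m)) :* (con 1 :+ con 2 :* (con 1 :+ m))
                          := (con 1 :+ con 2 :* m) :* (con 1 :+ con 2 :* m) :+ con 8 :* (con 1 :+ m)) refl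
  regroup : ∀ t s → 1 + 8 * t + 8 * s ≡ 1 + 8 * (s + t)
  regroup = solve 2 (λ t s → con 1 :+ con 8 :* t :+ con 8 :* s := con 1 :+ con 8 :* (s :+ t)) refl

sumOfSquares-positive-odd : ∀ {k} (d : Vec ℤ k) →
  (∀ i → Odd (lookup d i)) → (∀ i → + 0 ℤ.< lookup d i) →
  Σ ℕ (λ T → sumOfSquares d ≡ + (k + 8 * T) × (T ≡ 0 → d ≡ replicate k (+ 1)))
sumOfSquares-positive-odd [] _ _ = 0 , refl , λ _ → refl
sumOfSquares-positive-odd {suc k} (x ∷ d) odd pos
  with positive-odd (odd Fin.zero) (pos Fin.zero)
     | sumOfSquares-positive-odd d (λ i → odd (Fin.suc i)) (λ i → pos (Fin.suc i))
... | m , refl | T , sum≡ , T≡0⇒ones =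
  triangle m + T , sum≡′ , ones
  where
  sum≡′ : sumOfSquares (+ (1 + 2 * m) ∷ d) ≡ + (suc k + 8 * (triangle m + T))
  sum≡′ = begin
    + ((1 + 2 * m) * (1 + 2 * m)) +ℤ sumOfSquares d  ≡⟨ cong₂ _+ℤ_ (cong +_ (odd-square m)) sum≡ ⟩
    + (1 + 8 * triangle m + (k + 8 * T))            ≡⟨ cong +_ (regroup k (triangle m) T) ⟩
    + (suc k + 8 * (triangle m + T))                ∎
    where
    open ≡-Reasoning
    regroup : ∀ k t T → 1 + 8 * t + (k + 8 * T) ≡ suc k + 8 * (t + T)
    regroup = solve 3 (λ k t T → con 1 :+ con 8 :* t :+ (k :+ con 8 :* T) := con 1 :+ k :+ con 8 :* (t :+ T)) refl
  ones : triangle m + T ≡ 0 → + (1 + 2 * m) ∷ d ≡ replicate (suc k) (+ 1)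
  ones t+T≡0 with triangle≡0⇒≡0 m (m+n≡0⇒m≡0 (triangle m) t+T≡0)
  ... | refl = cong (+ 1 ∷_) (T≡0⇒ones (m+n≡0⇒n≡0 (triangle m) t+T≡0))

even-prime⇒≡2 : ∀ {p} → Prime p → 2 ∣ p → p ≡ 2
even-prime⇒≡2 pp 2∣p with prime⇒irreducible pp 2∣p
... | inj₂ 2≡p = sym 2≡p

positive-KleinianPrime⇒halves : ∀ p → KleinianPrime p → AllPositive p → p ≡ replicate 8 (+ 1)
positive-KleinianPrime⇒halves p (odd , r , norm , prime-r) pos
  with sumOfSquares-positive-odd p odd pos
... | T , sum≡ , T≡0⇒halves = T≡0⇒halves (cancel (even-prime⇒≡2 prime-r (divides (1 + T) r≡)))
  where
  r≡ : r ≡ (1 + T) * 2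
  r≡ = *-cancelˡ-≡ r ((1 + T) * 2) 4 (trans (+-injective (trans (sym norm) sum≡))
         (solve 1 (λ T → con 8 :+ con 8 :* T := con 4 :* ((con 1 :+ T) :* con 2)) refl T))
  cancel : r ≡ 2 → T ≡ 0
  cancel r≡2 = suc-injective (*-cancelʳ-≡ (1 + T) 1 2 (trans (sym r≡) r≡2))

mainTheorem9 : (n : ℕ) → ¬ Σ Half8 (λ p → Σ Half8 (λ q →
                 KleinianPrime p × KleinianPrime q × AllPositive p × AllPositive q
                 × p ⊕ q ≡ target (suc n)))
mainTheorem9 n (p , q , kp , kq , pp , pq , p⊕q≡target)
  with positive-KleinianPrime⇒halves p kp pp | positive-KleinianPrime⇒halves q kq pq
... | refl | refl with p⊕q≡target
...   | ()
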